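{- Let $M$ be an extension of $\mathsf{BS4}$, and let $\chi=(p\wedge\sim p)\to(q\vee\sim q)$ and $\chi'=\neg\neg(p\wedge\sim p)\to(q\vee\sim q)$. If $\mathrm{T}_{\mathbf{B}}\chi\in M$, then $\mathrm{T}_{\mathbf{B}}\chi'\in M$.
   Context: Language $\mathcal{L}^\Box_\sim=\{\wedge,\vee,\to,\bot,\sim,\Box,\Diamond\}$ ($\sim,\Box,\Diamond$ unary), formulas over a countable set of variables; $\neg\varphi:=\varphi\to\bot$, $\varphi\leftrightarrow\psi:=(\varphi\to\psi)\wedge(\psi\to\varphi)$, $\varphi\Leftrightarrow\psi:=(\varphi\leftrightarrow\psi)\wedge(\sim\varphi\leftrightarrow\sim\psi)$. A logic in $\mathcal{L}^\Box_\sim$ is a set of formulas closed under substitution, modus ponens, $\varphi\to\psi/\Box\varphi\to\Box\psi$ and $\varphi\to\psi/\Diamond\varphi\to\Diamond\psi$. $\mathsf{BS4}$ is the least logic containing the intuitionistic axioms ($p\to(q\to p)$; $(p\to(q\to r))\to((p\to q)\to(p\to r))$; $p\wedge q\to p$; $p\wedge q\to q$; $p\to(q\to p\wedge q)$; $p\to p\vee q$; $q\to p\vee q$; $(p\to r)\to((q\to r)\to(p\vee q\to r))$; $\bot\to p$), $p\vee\neg p$, $\sim(p\vee q)\leftrightarrow(\sim p\wedge\sim q)$, $\sim(p\wedge q)\leftrightarrow(\sim p\vee\sim q)$, $\sim(p\to q)\leftrightarrow(p\wedge\sim q)$, $\sim\sim p\leftrightarrow p$, $\sim\bot$, $\Box(p\to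 p)$, $(\Box p\wedge\Box q)\to\Box(p\wedge q)$, $\Box p\to p$, $\Box p\to\Box\Box p$, $\neg\Box p\leftrightarrow\Diamond\neg p$, $\neg\Diamond p\leftrightarrow\Box\neg p$, $\Box p\Leftrightarrow\sim\Diamond\sim p$, $\Diamond p\Leftrightarrow\sim\Box\sim p$; an extension is a logic containing it. Translation $\mathrm{T}_{\mathbf{B}}$ of $\{\wedge,\vee,\to,\bot,\sim\}$-formulas: $\mathrm{T}_{\mathbf{B}}(p)=\Box p$, $\mathrm{T}_{\mathbf{B}}(\sim p)=\Box\sim p$, $\mathrm{T}_{\mathbf{B}}(\bot)=\bot$, $\mathrm{T}_{\mathbf{B}}(\sim\bot)=\sim\bot$, $\mathrm{T}_{\mathbf{B}}(\varphi\wedge\psi)=\mathrm{T}_{\mathbf{B}}\varphi\wedge\mathrm{T}_{\mathbf{B}}\psi$, $\mathrm{T}_{\mathbf{B}}(\varphi\vee\psi)=\mathrm{T}_{\mathbf{B}}\varphi\vee\mathrm{T}_{\mathbf{B}}\psi$, $\mathrm{T}_{\mathbf{B}}(\varphi\to\psi)=\Box(\mathrm{T}_{\mathbf{B}}\varphi\to\mathrm{T}_{\mathbf{B}}\psi)$, $\mathrm{T}_{\mathbf{B}}(\sim(\varphi\wedge\psi))=\mathrm{T}_{\mathbf{B}}(\sim\varphi)\vee\mathrm{T}_{\mathbf{B}}(\sim\psi)$, $\mathrm{T}_{\mathbf{B}}(\sim(\varphi\vee\psi))=\mathrm{T}_{\mathbf{B}}(\sim\varphi)\wedge\mathrm{T}_{\mathbf{B}}(\sim\psi)$,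 $\mathrm{T}_{\mathbf{B}}(\sim(\varphi\to\psi))=\mathrm{T}_{\mathbf{B}}\varphi\wedge\mathrm{T}_{\mathbf{B}}(\sim\psi)$, $\mathrm{T}_{\mathbf{B}}(\sim\sim\varphi)=\mathrm{T}_{\mathbf{B}}\varphi$. In particular $\mathrm{T}_{\mathbf{B}}\chi=\Box((\Box p\wedge\Box\sim p)\to(\Box q\vee\Box\sim q))$. -}

module Defs where

open import Data.Nat using (ℕ)

infixr 5 _⇒_
infixl 6 _∨_
infixl 7 _∧_
data Fm : Set where
  var : ℕ → Fm
  ⊥'  : Fm
  _∧_ : Fm → Fm → Fm
  _∨_ : Fm → Fm → Fm
  _⇒_ : Fm → Fm → Fm
  ∼_  : Fm → Fm
  □_  : Fm → Fm
  ◇_  : Fm → Fm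

¬'_ : Fm → Fm
¬' φ = φ ⇒ ⊥'

_⇔_ : Fm → Fm → Fm
φ ⇔ ψ = (φ ⇒ ψ) ∧ (ψ ⇒ φ)

_⇔∼_ : Fm → Fm → Fm   -- strong equivalence  φ ⇔ ψ  of the paper
φ ⇔∼ ψ = (φ ⇔ ψ) ∧ ((∼ φ) ⇔ (∼ ψ))

_[_] : Fm → (ℕ → Fm) → Fm
var n   [ σ ] = σ n
⊥'      [ σ ] = ⊥'
(φ ∧ ψ) [ σ ] = (φ [ σ ]) ∧ (ψ [ σ ])
(φ ∨ ψ) [ σ ] = (φ [ σ ]) ∨ (ψ [ σ ])
(φ ⇒ ψ) [ σ ] = (φ [ σ ]) ⇒ (ψ [ σ ])
(∼ φ)   [ σ ] = ∼ (φ [ σ ])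
(□ φ)   [ σ ] = □ (φ [ σ ])
(◇ φ)   [ σ ] = ◇ (φ [ σ ])

p q r : Fm
p = var 0
q = var 1
r = var 2

data Axiom : Fm → Set where
  i1  : Axiom (p ⇒ (q ⇒ p))
  i2  : Axiom ((p ⇒ (q ⇒ r)) ⇒ ((p ⇒ q) ⇒ (p ⇒ r)))
  i3  : Axiom (p ∧ q ⇒ p)
  i4  : Axiom (p ∧ q ⇒ q)
  i5  : Axiom (p ⇒ (q ⇒ p ∧ q))
  i6  : Axiom (p ⇒ p ∨ q)
  i7  : Axiom (q ⇒ p ∨ q)
  i8  : Axiom ((p ⇒ r) ⇒ ((q ⇒ r) ⇒ (p ∨ q ⇒ r)))
  i9  : Axiom (⊥' ⇒ p)
  em  : Axiom (p ∨ ¬' p)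
  n∨  : Axiom ((∼ (p ∨ q)) ⇔ ((∼ p) ∧ (∼ q)))
  n∧  : Axiom ((∼ (p ∧ q)) ⇔ ((∼ p) ∨ (∼ q)))
  n⇒  : Axiom ((∼ (p ⇒ q)) ⇔ (p ∧ (∼ q)))
  nn  : Axiom ((∼ (∼ p)) ⇔ p)
  n⊥  : Axiom (∼ ⊥')
  bN  : Axiom (□ (p ⇒ p))
  bC  : Axiom ((□ p ∧ □ q) ⇒ □ (p ∧ q))
  bT  : Axiom (□ p ⇒ p)
  b4  : Axiom (□ p ⇒ □ (□ p))
  nb  : Axiom ((¬' (□ p)) ⇔ (◇ (¬' p)))
  nd  : Axiom ((¬' (◇ p)) ⇔ (□ (¬' p)))
  bd  : Axiom ((□ p) ⇔∼ (∼ (◇ (∼ p))))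
  db  : Axiom ((◇ p) ⇔∼ (∼ (□ (∼ p))))

record IsLogic (M : Fm → Set) : Set where
  field
    closed-subst : ∀ φ (σ : ℕ → Fm) → M φ → M (φ [ σ ])
    closed-mp    : ∀ φ ψ → M φ → M (φ ⇒ ψ) → M ψ
    closed-□     : ∀ φ ψ → M (φ ⇒ ψ) → M (□ φ ⇒ □ ψ)
    closed-◇     : ∀ φ ψ → M (φ ⇒ ψ) → M (◇ φ ⇒ ◇ ψ)

data BS4 : Fm → Set where
  ax    : ∀ {φ} → Axiom φ → BS4 φ
  sub   : ∀ φ (σ : ℕ → Fm) → BS4 φ → BS4 (φ [ σ ])
  mp    : ∀ φ ψ → BS4 φ → BS4 (φ ⇒ ψ) → BS4 ψ
  mon□  : ∀ φ ψ → BS4 (φ ⇒ ψ) → BS4 (□ φ ⇒ □ ψ)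
  mon◇  : ∀ φ ψ → BS4 (φ ⇒ ψ) → BS4 (◇ φ ⇒ ◇ ψ)

record ExtendsBS4 (M : Fm → Set) : Set where
  field
    isLogic  : IsLogic M
    contains : ∀ φ → BS4 φ → M φ

data Fm₀ : Set where
  var : ℕ → Fm₀
  ⊥'  : Fm₀
  _∧_ : Fm₀ → Fm₀ → Fm₀
  _∨_ : Fm₀ → Fm₀ → Fm₀
  _⇒_ : Fm₀ → Fm₀ → Fm₀
  ∼_  : Fm₀ → Fm₀

-- Translation T_B; TBn φ computes T_B(∼ φ).
TB  : Fm₀ → Fm
TBn : Fm₀ → Fm
TB (var n) = □ (var n)
TB ⊥'      = ⊥'
TB (φ ∧ ψ) = TB φ ∧ TB ψ
TB (φ ∨ ψ) = TB φ ∨ TB ψ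
TB (φ ⇒ ψ) = □ (TB φ ⇒ TB ψ)
TB (∼ φ)   = TBn φ
TBn (var n) = □ (∼ (var n))
TBn ⊥'      = ∼ ⊥'
TBn (φ ∧ ψ) = TBn φ ∨ TBn ψ
TBn (φ ∨ ψ) = TBn φ ∧ TBn ψ
TBn (φ ⇒ ψ) = TB φ ∧ TBn ψ
TBn (∼ φ)   = TB φ

¬₀_ : Fm₀ → Fm₀
¬₀ φ = φ ⇒ ⊥'

p₀ q₀ : Fm₀
p₀ = var 0
q₀ = var 1

χ : Fm₀
χ = (p₀ ∧ (∼ p₀)) ⇒ (q₀ ∨ (∼ q₀))

χ' : Fm₀
χ' = (¬₀ (¬₀ (p₀ ∧ (∼ p₀)))) ⇒ (q₀ ∨ (∼ q₀))

-- Substituting ◇□p for p in T_B χ = □(□p ∧ □∼p → B) yields □(□◇□p ∧ □∼◇□p → B).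
-- The antecedent □¬□¬(□p ∧ □∼p) of T_B χ' implies □◇(□p ∧ □∼p) (using excluded
-- middle), which gives □◇□p and, via □∼p → ∼p, ◇∼p ↔ ∼□p and axiom 4, also □∼◇□p.
module Submission where

open import Data.Nat using (ℕ; zero; suc)
open import Defs

⟨_,_,_⟩ : Fm → Fm → Fm → ℕ → Fm
⟨ a , b , c ⟩ zero                = a
⟨ a , b , c ⟩ (suc zero)          = b
⟨ a , b , c ⟩ (suc (suc zero))    = c
⟨ a , b , c ⟩ (suc (suc (suc n))) = var (suc (suc (suc n)))

glut : Fm → Fm
glut a = □ a ∧ □ (∼ a)

module Extension {M : Fm → Set} (ext : ExtendsBS4 M) where
  open ExtendsBS4 ext
  open IsLogic isLogic

  axiom : ∀ {φ} → Axiom φ → ∀ a b c → M (φ [ ⟨ a , b , c ⟩ ])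
  axiom A a b c = closed-subst _ _ (contains _ (ax A))

  infixl 4 _·_
  _·_ : ∀ {a b} → M (a ⇒ b) → M a → M b
  f · x = closed-mp _ _ x f

  K : ∀ {a b} → M (a ⇒ (b ⇒ a))
  K {a} {b} = axiom i1 a b ⊥'

  S : ∀ {a b c} → M ((a ⇒ (b ⇒ c)) ⇒ ((a ⇒ b) ⇒ (a ⇒ c)))
  S {a} {b} {c} = axiom i2 a b c

  ⇒-refl : ∀ {a} → M (a ⇒ a)
  ⇒-refl {a} = S · K · K {b = a}

  ⇒-trans : ∀ {a b c} → M (a ⇒ b) → M (b ⇒ c) → M (a ⇒ c)
  ⇒-trans f g = S · (K · g) · f

  ∧-intro : ∀ {x a b} → M (x ⇒ a) → M (x ⇒ b) → M (x ⇒ a ∧ b)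
  ∧-intro {a = a} {b} f g = S · ⇒-trans f (axiom i5 a b ⊥') · g

  ∧-elimˡ : ∀ {a b} → M (a ∧ b ⇒ a)
  ∧-elimˡ {a} {b} = axiom i3 a b ⊥'

  ∧-elimʳ : ∀ {a b} → M (a ∧ b ⇒ b)
  ∧-elimʳ {a} {b} = axiom i4 a b ⊥'

  modus-ponens : ∀ {a b} → M (a ⇒ ((a ⇒ b) ⇒ b))
  modus-ponens = ⇒-trans K (S · ⇒-refl)

  ¬⇒¬¬⇒ : ∀ {a b} → M (¬' a ⇒ (¬' (¬' a) ⇒ b))
  ¬⇒¬¬⇒ {b = b} = ⇒-trans modus-ponens (S · (K · axiom i9 b ⊥' ⊥'))

  ¬¬-elim : ∀ {a} → M (¬' (¬' a) ⇒ a)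
  ¬¬-elim {a} = axiom i8 a (¬' a) (¬' (¬' a) ⇒ a) · K · ¬⇒¬¬⇒ · axiom em a ⊥' ⊥'

  □-mono : ∀ {a b} → M (a ⇒ b) → M (□ a ⇒ □ b)
  □-mono = closed-□ _ _

  ◇-mono : ∀ {a b} → M (a ⇒ b) → M (◇ a ⇒ ◇ b)
  ◇-mono = closed-◇ _ _

  necessitation : ∀ {a} → M a → M (□ a)
  necessitation h = □-mono (K · h) · contains _ (ax bN)

  □-T : ∀ {a} → M (□ a ⇒ a)
  □-T {a} = axiom bT a ⊥' ⊥'

  □-4 : ∀ {a} → M (□ a ⇒ □ (□ a))
  □-4 {a} = axiom b4 a ⊥' ⊥'

  ∼∼-intro : ∀ {a} → M (a ⇒ ∼ (∼ a))
  ∼∼-intro {a} = ∧-elimʳ · axiom nn a ⊥' ⊥'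

  ¬□¬⇒◇ : ∀ {a} → M (¬' (□ (¬' a)) ⇒ ◇ a)
  ¬□¬⇒◇ {a} = ⇒-trans (∧-elimˡ · axiom nb (¬' a) ⊥' ⊥') (◇-mono ¬¬-elim)

  ◇∼⇒∼□ : ∀ {a} → M (◇ (∼ a) ⇒ ∼ (□ a))
  ◇∼⇒∼□ {a} = ⇒-trans ∼∼-intro (∧-elimʳ · (∧-elimʳ · axiom bd a ⊥' ⊥'))

  □∼⇒∼◇ : ∀ {a} → M (□ (∼ a) ⇒ ∼ (◇ a))
  □∼⇒∼◇ {a} = ⇒-trans ∼∼-intro (∧-elimʳ · (∧-elimʳ · axiom db a ⊥' ⊥'))

  □◇glut⇒glut◇□ : ∀ {a} → M (□ (◇ (glut a)) ⇒ glut (◇ (□ a)))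
  □◇glut⇒glut◇□ = ∧-intro (□-mono (◇-mono ∧-elimˡ)) □∼◇□
    where
    □∼◇□ : ∀ {a} → M (□ (◇ (glut a)) ⇒ □ (∼ (◇ (□ a))))
    □∼◇□ = ⇒-trans (□-mono (⇒-trans (◇-mono (⇒-trans ∧-elimʳ □-T)) ◇∼⇒∼□))
                   (⇒-trans □-4 (□-mono □∼⇒∼◇))

lemma4p2p1 : (M : Fm → Set) → ExtendsBS4 M → M (TB χ) → M (TB χ')
lemma4p2p1 M ext hχ =
  necessitation (⇒-trans (□-mono ¬□¬⇒◇) (⇒-trans □◇glut⇒glut◇□ hχ[◇□p/p]))
  where
  open Extension ext
  open IsLogic (ExtendsBS4.isLogic ext)
  hχ[◇□p/p] : M (glut (◇ (□ p)) ⇒ □ q ∨ □ (∼ q))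
  hχ[◇□p/p] = □-T · closed-subst _ ⟨ ◇ (□ p) , q , r ⟩ hχ
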